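{- Let $n\ge2$ and let $\ell:[n]\to[n]$ be a bijection. If $(rt_H,rt_P,\ell,S)$ is a nested ranked topology with nesting sequence $S=(HP)^{n-1}$, then the host and parasite ranked tree topologies are matching: $rt_H=rt_P$ as ranked tree topologies on $n$ taxa (identifying the leaf labels via $\ell$).
   Context: An ultrametric phylogenetic tree on a finite leaf set is a rooted tree with bijectively labelled leaves, no non-root degree-2 vertices, nonnegative edge lengths and all leaves equidistant from the root; internal vertices have times (distance to descendant leaves), leaves time $0$; $d_T(i,j)$ is leaf-to-leaf path length. A nested tree of type $(n,n,\ell)$ is a pair $(T_H,T_P)$ of such trees on $[n]$ (host) and $[n]$ (parasite) with $d^P(i,j)\ge d^H(\ell(i),\ell(j))$ for all $i,j$. It is fully resolved if both trees are binary and all $2n-2$ internal times are distinct; listing the internal vertices by increasing time, the nesting sequence $S\in\{H,P\}^{2n-2}$ has $S_i=H$ or $P$ according as the $i$-th vertex lies in $T_H$ or $T_P$. The ranked tree topology of a binary tree with distinct internal times is its leaf-labelled rooted shape together with the total order of its internal vertices by time. A nested ranked topology is a tuple $(rt_H,rt_P,\ell,S)$ arising as (host ranked topology, parasite ranked topology, leaf map, nesting sequence) of some fully resolved nested tree.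
   Formalization: The vertex times and edge lengths of the host and parasite ultrametric trees are rational. -}

module Defs where

open import Data.Nat using (ℕ; zero; suc)
open import Data.Fin using (Fin)
open import Data.Fin.Properties using () renaming (_≟_ to _≟ᶠ_)
open import Data.Bool using (Bool; true; false; _∨_; _∧_; if_then_else_)
open import Data.List using (List; []; _∷_; _++_; map; length; filter; allFin)
open import Data.List.Relation.Binary.Permutation.Propositional using (_↭_)
open import Data.List.Relation.Unary.Unique.Propositional using (Unique)
open import Data.Product using (_×_)
open import Data.Unit using (⊤)
open import Relation.Nullary using (yes; no)
open import Relation.Nullary.Decidable using (⌊_⌋)
open import Relation.Binary.PropositionalEquality using (_≡_)
open import Data.Rational using (ℚ; 0ℚ; _+_; _≤_; _<?_)
open import Data.Rational.Properties using (≤-decTotalOrder)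
open import Data.List.Sort.MergeSort.Base ≤-decTotalOrder using (sort)

-- Rooted binary trees with leaves labelled in Fin n and internal
-- vertices labelled by an element of A (a time, or a rank).
-- Children are stored in some order; the order carries no meaning
-- (see _≅_ below).

data Tree (A : Set) (n : ℕ) : Set where
  leaf : Fin n → Tree A n
  node : A → Tree A n → Tree A n → Tree A n

module _ {A : Set} {n : ℕ} where

  leaves : Tree A n → List (Fin n)
  leaves (leaf i)     = i ∷ []
  leaves (node _ l r) = leaves l ++ leaves r

  internals : Tree A n → List A
  internals (leaf _)     = []
  internals (node a l r) = a ∷ internals l ++ internals r

  relabel : (Fin n → Fin n) → Tree A n → Tree A n
  relabel f (leaf i)     = leaf (f i)
  relabel f (node a l r) = node a (relabel f l) (relabel f r)

  contains : Fin n → Tree A n → Bool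
  contains i (leaf j)     = ⌊ i ≟ᶠ j ⌋
  contains i (node _ l r) = contains i l ∨ contains i r

-- Ultrametric binary trees given by vertex times (leaves have time 0,
-- the edge from a vertex of time t to its child of time s has length
-- t - s, required nonnegative).

time : {n : ℕ} → Tree ℚ n → ℚ
time (leaf _)     = 0ℚ
time (node t _ _) = t

NonnegEdges : {n : ℕ} → Tree ℚ n → Set
NonnegEdges (leaf _)     = ⊤
NonnegEdges (node t l r) = (time l ≤ t) × (time r ≤ t) × NonnegEdges l × NonnegEdges r

IsUltrametricBinaryTree : {n : ℕ} → Tree ℚ n → Set
IsUltrametricBinaryTree {n} T = (leaves T ↭ allFin n) × NonnegEdges T

-- leaf-to-leaf path length d_T(i,j); in an ultrametric tree this is
-- twice the time of the most recent common ancestor (0 if i = j)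
dist : {n : ℕ} → Tree ℚ n → Fin n → Fin n → ℚ
dist (leaf _)     i j = 0ℚ
dist (node t l r) i j =
  if contains i l ∧ contains j l then dist l i j
  else if contains i r ∧ contains j r then dist r i j
  else t + t

IsNested : {n : ℕ} → (Fin n → Fin n) → Tree ℚ n → Tree ℚ n → Set
IsNested ℓ TH TP = ∀ i j → dist TH (ℓ i) (ℓ j) ≤ dist TP i j

-- fully resolved: (both trees binary, by construction, and) all 2n-2
-- internal times distinct
FullyResolved : {n : ℕ} → Tree ℚ n → Tree ℚ n → Set
FullyResolved TH TP = Unique (internals TH ++ internals TP)

data HP : Set where
  H P : HP

mergeTag : List ℚ → List ℚ → List HP
mergeTag []       ys       = map (λ _ → P) ys
mergeTag (x ∷ xs) []       = H ∷ mergeTag xs []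
mergeTag (x ∷ xs) (y ∷ ys) =
  if ⌊ x <? y ⌋ then H ∷ mergeTag xs (y ∷ ys) else P ∷ mergeTag (x ∷ xs) ys

nestingSeq : {n : ℕ} → Tree ℚ n → Tree ℚ n → List HP
nestingSeq TH TP = mergeTag (sort (internals TH)) (sort (internals TP))

HPpow : ℕ → List HP
HPpow zero    = []
HPpow (suc k) = H ∷ P ∷ HPpow k

-- rank of a time t among the internal times of T (0 = earliest)
rankIn : {n : ℕ} → Tree ℚ n → ℚ → ℕ
rankIn T t = length (filter (_<? t) (internals T))

rankedTopology : {n : ℕ} → Tree ℚ n → Tree ℕ n
rankedTopology {n} T = go T
  where
  go : Tree ℚ n → Tree ℕ n
  go (leaf i)     = leaf i
  go (node t l r) = node (rankIn T t) (go l) (go r)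

data _≅_ {n : ℕ} : Tree ℕ n → Tree ℕ n → Set where
  leaf≅ : ∀ i → leaf i ≅ leaf i
  node≅ : ∀ k {l r l′ r′} → l ≅ l′ → r ≅ r′ → node k l r ≅ node k l′ r′
  swap≅ : ∀ k {l r l′ r′} → l ≅ r′ → r ≅ l′ → node k l r ≅ node k l′ r′

{-# OPTIONS --safe #-}
module Submission where

open import Defs
open import Data.Nat using (ℕ; _≤_; _∸_)
open import Data.Fin using (Fin)
open import Data.Rational using (ℚ)
open import Function.Definitions using (Bijective)
open import Relation.Binary.PropositionalEquality using (_≡_)

open import Data.Bool using (true; false; _∧_; _∨_; if_then_else_)
open import Data.Bool.Properties using (∧-comm; ∨-zeroʳ)
open import Data.Empty using (⊥-elim)
open import Data.Fin.Properties using () renaming (_≟_ to _≟ᶠ_)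
open import Data.List using (List; []; _∷_; _++_; map; length; filter; allFin)
open import Data.List.Membership.Propositional using (_∈_; _∉_)
open import Data.List.Membership.Propositional.Properties
  using (∈-++⁺ˡ; ∈-++⁺ʳ; ∈-++⁻; ∈-map⁺; ∈-map⁻; ∈-allFin)
open import Data.List.Properties using (map-++; filter-accept; filter-reject; filter-none)
open import Data.List.Relation.Binary.Disjoint.Propositional using (Disjoint)
open import Data.List.Relation.Binary.Permutation.Propositional using (_↭_; ↭-sym; ↭⇒↭ₛ)
open import Data.List.Relation.Binary.Permutation.Propositional.Properties
  using (filter-↭; ↭-length; ∈-resp-↭)
import Data.List.Relation.Binary.Permutation.Setoid.Properties as Permutationₛ
open import Data.List.Relation.Binary.Sublist.Propositional using (⊆-refl)
open import Data.List.Relation.Binary.Sublist.Propositional.Properties using (filter⁺; length-mono-≤)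
import Data.List.Relation.Unary.All as All
open import Data.List.Relation.Unary.All using (All; []; _∷_)
open import Data.List.Relation.Unary.All.Properties using (++⁺; ++⁻ˡ; ++⁻ʳ; map⁺)
import Data.List.Relation.Unary.AllPairs as AllPairs
open import Data.List.Relation.Unary.AllPairs using (AllPairs)
open import Data.List.Relation.Unary.Any using (here; there)
open import Data.List.Relation.Unary.Linked.Properties using (Linked⇒AllPairs)
open import Data.List.Relation.Unary.Unique.Propositional using (Unique; []; _∷_)
open import Data.List.Relation.Unary.Unique.Propositional.Properties using (allFin⁺)
import Data.Maybe as Maybe
open import Data.Maybe using (Maybe; just; nothing; maybe)
open import Data.Maybe.Properties using (just-injective)
open import Data.Nat using (zero; suc; z≤n; s≤s; _<_; _⊔_)
open import Data.Nat.Induction using (<-rec)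
open import Data.Nat.Properties
  using (suc-injective; 1+n≰n; ≤-refl; ≤-trans; ≤-reflexive; ≤-antisym; <-irrefl; <⇒≢; m≤n⇒m<n∨m≡n;
         m≤n⇒m≤1+n; ⊔-lub; ⊔-monoʳ-≤; m≤m⊔n; m≤n⇒m≤o⊔n; m≤n⇒m≤n⊔o)
open import Data.Product using (∃; ∃₂; _×_; _,_; proj₁; proj₂)
import Data.Rational as ℚ
open import Data.Rational using (0ℚ)
import Data.Rational.Properties as ℚₚ
open import Data.Sum using (_⊎_; inj₁; inj₂)
open import Function.Base using (_∘_)
open import Function.Definitions using (Injective; Surjective)
open import Relation.Binary.Definitions using (tri<; tri≈; tri>)
open import Relation.Binary.PropositionalEquality
  using (setoid; _≢_; refl; sym; trans; cong; cong₂; subst; subst₂)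
open import Relation.Nullary using (¬_; yes; no; contradiction)
open import Relation.Nullary.Decidable using (dec-true; isYes≗does)
open import Data.List.Sort.MergeSort.Base ℚₚ.≤-decTotalOrder using (sort)
open import Data.List.Sort.MergeSort.Properties ℚₚ.≤-decTotalOrder using (sort-↭; sort-↗)

-- Replace every internal time by its rank, placing the vertex of rank k at height k + 1 above the
-- leaves: the host tree becomes a ranked tree X and the parasite tree, with its leaves renamed by
-- ℓ, a ranked tree Y. A ranked tree is determined by the heights of the most recent common
-- ancestors of its pairs of leaves, so it suffices to show that X and Y have the same heights.
--
-- The nesting sequence (HP)^(n-1) says h₀ < p₀ < h₁ < p₁ < ⋯ for the sorted host and parasite
-- times. Hence a time t ≥ hₖ exceeds p₀, …, pₖ₋₁, which together with the nesting inequality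
-- gives height X ≤ height Y; moreover hₖ and pₖ both have rank k. Equality follows by strong
-- induction on height X a b = j + 1: the parasite vertex of rank j joins two leaves x and y, which
-- are then joined at rank j in X as well. Since X is binary with distinct ranks, a and b lie in
-- the two clades below that vertex, whose heights agree in X and Y by induction, and the
-- ultrametric inequality in Y gives height Y a b ≤ j + 1.

Unique-++⁻ : {A : Set} (xs : List A) {ys : List A} →
             Unique (xs ++ ys) → Unique xs × Unique ys × Disjoint xs ys
Unique-++⁻ []       u        = [] , u , λ ()
Unique-++⁻ (x ∷ xs) {ys} (x∉ ∷ u) with Unique-++⁻ xs u
... | uxs , uys , xs#ys = ++⁻ˡ xs x∉ ∷ uxs , uys , x∷xs#ys
  where
  x∷xs#ys : Disjoint (x ∷ xs) ys
  x∷xs#ys (here refl , x∈ys)  = All.lookup (++⁻ʳ xs x∉) x∈ys refl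
  x∷xs#ys (there v∈xs , v∈ys) = xs#ys (v∈xs , v∈ys)

Unique-resp-↭ : {A : Set} {xs ys : List A} → xs ↭ ys → Unique xs → Unique ys
Unique-resp-↭ {A} xs↭ys = Permutationₛ.Unique-resp-↭ (setoid A) (↭⇒↭ₛ xs↭ys)

Unique-map⁺ : {A B : Set} {f : A → B} {xs : List A} →
              (∀ {u v} → u ∈ xs → v ∈ xs → f u ≡ f v → u ≡ v) → Unique xs → Unique (map f xs)
Unique-map⁺ f-inj []       = []
Unique-map⁺ f-inj (x∉ ∷ U) =
  map⁺ (All.tabulate λ v∈ fx≡fv → All.lookup x∉ v∈ (f-inj (here refl) (there v∈) fx≡fv))
  ∷ Unique-map⁺ (λ u∈ v∈ → f-inj (there u∈) (there v∈)) U

surjective-∀₂ : {A B : Set} {f : A → B} {R : B → B → Set} → Surjective _≡_ _≡_ f →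
                (∀ i j → R (f i) (f j)) → ∀ a b → R a b
surjective-∀₂ {R = R} surjective R-image a b =
  let i , fi≡a = surjective a
      j , fj≡b = surjective b
  in  subst₂ R (fi≡a refl) (fj≡b refl) (R-image i j)

variable
  A : Set
  n : ℕ
  a b c x y : Fin n
  t u v : ℚ
  xs ys : List ℚ

-- Leaves and most recent common ancestors

infix 4 _∈ᵀ_ _∉ᵀ_

data _∈ᵀ_ {A : Set} {n : ℕ} (a : Fin n) : Tree A n → Set where
  here  : a ∈ᵀ leaf a
  left  : ∀ {t l r} → a ∈ᵀ l → a ∈ᵀ node t l r
  right : ∀ {t l r} → a ∈ᵀ r → a ∈ᵀ node t l r

_∉ᵀ_ : Fin n → Tree A n → Set
a ∉ᵀ T = ¬ a ∈ᵀ T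

module _ {A : Set} {n : ℕ} where

  contains⁺ : {T : Tree A n} → a ∈ᵀ T → contains a T ≡ true
  contains⁺ {a = a} here                 = trans (isYes≗does (a ≟ᶠ a)) (dec-true (a ≟ᶠ a) refl)
  contains⁺ (left a∈l)                   rewrite contains⁺ a∈l = refl
  contains⁺ {T = node _ l _} (right a∈r) rewrite contains⁺ a∈r = ∨-zeroʳ (contains _ l)

  contains⁻ : {T : Tree A n} → contains a T ≡ true → a ∈ᵀ T
  contains⁻ {a = a} {T = leaf b} _ with a ≟ᶠ b
  ... | yes refl = here
  contains⁻ {a = a} {T = node _ l r} e with contains a l in el
  ... | true  = left (contains⁻ el)
  ... | false = right (contains⁻ e)

  contains-∉ : {T : Tree A n} → a ∉ᵀ T → contains a T ≡ false
  contains-∉ {a = a} {T = T} a∉T with contains a T in e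
  ... | true  = ⊥-elim (a∉T (contains⁻ e))
  ... | false = refl

  someLeaf : (T : Tree A n) → ∃ (_∈ᵀ T)
  someLeaf (leaf a)     = a , here
  someLeaf (node _ l _) = proj₁ (someLeaf l) , left (proj₂ (someLeaf l))

  data UniqueLeaves : Tree A n → Set where
    leaf : UniqueLeaves (leaf a)
    node : ∀ {t l r} → UniqueLeaves l → UniqueLeaves r → (∀ {a} → a ∈ᵀ l → a ∉ᵀ r) →
           UniqueLeaves (node t l r)

  ∈ᵀ⇒∈leaves : {T : Tree A n} → a ∈ᵀ T → a ∈ leaves T
  ∈ᵀ⇒∈leaves here                          = here refl
  ∈ᵀ⇒∈leaves (left a∈l)                    = ∈-++⁺ˡ (∈ᵀ⇒∈leaves a∈l)
  ∈ᵀ⇒∈leaves {T = node _ l _} (right a∈r) = ∈-++⁺ʳ (leaves l) (∈ᵀ⇒∈leaves a∈r)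

  ∈leaves⇒∈ᵀ : (T : Tree A n) → a ∈ leaves T → a ∈ᵀ T
  ∈leaves⇒∈ᵀ (leaf _)     (here refl) = here
  ∈leaves⇒∈ᵀ (node _ l r) a∈         with ∈-++⁻ (leaves l) a∈
  ... | inj₁ a∈l = left (∈leaves⇒∈ᵀ l a∈l)
  ... | inj₂ a∈r = right (∈leaves⇒∈ᵀ r a∈r)

  unique⇒UniqueLeaves : (T : Tree A n) → Unique (leaves T) → UniqueLeaves T
  unique⇒UniqueLeaves (leaf _)     _ = leaf
  unique⇒UniqueLeaves (node _ l r) u =
    let ul , ur , l#r = Unique-++⁻ (leaves l) u
    in  node (unique⇒UniqueLeaves l ul) (unique⇒UniqueLeaves r ur)
             (λ a∈l a∈r → l#r (∈ᵀ⇒∈leaves a∈l , ∈ᵀ⇒∈leaves a∈r))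

  spanning-complete : {T : Tree A n} → leaves T ↭ allFin n → ∀ a → a ∈ᵀ T
  spanning-complete {T} leaves↭ a = ∈leaves⇒∈ᵀ T (∈-resp-↭ (↭-sym leaves↭) (∈-allFin a))

  spanning-uniqueLeaves : {T : Tree A n} → leaves T ↭ allFin n → UniqueLeaves T
  spanning-uniqueLeaves {T} leaves↭ = unique⇒UniqueLeaves T (Unique-resp-↭ (↭-sym leaves↭) (allFin⁺ n))

  module _ {f : Fin n → Fin n} where

    relabel-∈ : {T : Tree A n} → a ∈ᵀ T → f a ∈ᵀ relabel f T
    relabel-∈ here        = here
    relabel-∈ (left a∈l)  = left (relabel-∈ a∈l)
    relabel-∈ (right a∈r) = right (relabel-∈ a∈r)

    relabel-∈⁻ : {T : Tree A n} → b ∈ᵀ relabel f T → ∃ λ a → a ∈ᵀ T × f a ≡ b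
    relabel-∈⁻ {T = leaf a}     here        = a , here , refl
    relabel-∈⁻ {T = node _ _ _} (left b∈l)  = let a , a∈l , e = relabel-∈⁻ b∈l in a , left a∈l , e
    relabel-∈⁻ {T = node _ _ _} (right b∈r) = let a , a∈r , e = relabel-∈⁻ b∈r in a , right a∈r , e

    relabel-uniqueLeaves : Injective _≡_ _≡_ f → (T : Tree A n) →
                           UniqueLeaves T → UniqueLeaves (relabel f T)
    relabel-uniqueLeaves inj (leaf _)     leaf             = leaf
    relabel-uniqueLeaves inj (node _ l r) (node ul ur l#r) =
      node (relabel-uniqueLeaves inj l ul) (relabel-uniqueLeaves inj r ur) disjoint
      where
      disjoint : ∀ {b} → b ∈ᵀ relabel f l → b ∉ᵀ relabel f r
      disjoint b∈l b∈r with relabel-∈⁻ b∈l | relabel-∈⁻ b∈r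
      ... | a , a∈l , refl | a′ , a′∈r , e = l#r a∈l (subst (_∈ᵀ r) (inj e) a′∈r)

    contains-relabel : Injective _≡_ _≡_ f → (T : Tree A n) →
                       contains (f a) (relabel f T) ≡ contains a T
    contains-relabel {a = a} inj (leaf c) with f a ≟ᶠ f c | a ≟ᶠ c
    ... | yes _     | yes _   = refl
    ... | no  _     | no  _   = refl
    ... | yes fa≡fc | no a≢c  = ⊥-elim (a≢c (inj fa≡fc))
    ... | no fa≢fc  | yes a≡c = ⊥-elim (fa≢fc (cong f a≡c))
    contains-relabel inj (node _ l r) = cong₂ _∨_ (contains-relabel inj l) (contains-relabel inj r)

    internals-relabel : (T : Tree A n) → internals (relabel f T) ≡ internals T
    internals-relabel (leaf _)     = refl
    internals-relabel (node t l r) = cong (t ∷_) (cong₂ _++_ (internals-relabel l) (internals-relabel r))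

  -- Opaque, so that the tree in `mrca T a b` can be inferred by unification.
  opaque
    mrca : Tree A n → Fin n → Fin n → Maybe A
    mrca (leaf _)     a b = nothing
    mrca (node t l r) a b =
      if contains a l ∧ contains b l then mrca l a b
      else if contains a r ∧ contains b r then mrca r a b
      else just t

    mrca-left : {t : A} {l r : Tree A n} → a ∈ᵀ l → b ∈ᵀ l → mrca (node t l r) a b ≡ mrca l a b
    mrca-left a∈l b∈l rewrite contains⁺ a∈l | contains⁺ b∈l = refl

    mrca-right : {t : A} {l r : Tree A n} → UniqueLeaves (node t l r) → a ∈ᵀ r → b ∈ᵀ r →
                 mrca (node t l r) a b ≡ mrca r a b
    mrca-right (node _ _ l#r) a∈r b∈r
      rewrite contains-∉ (λ a∈l → l#r a∈l a∈r) | contains⁺ a∈r | contains⁺ b∈r = refl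

    mrca-across : {t : A} {l r : Tree A n} → UniqueLeaves (node t l r) → a ∈ᵀ l → b ∈ᵀ r →
                  mrca (node t l r) a b ≡ just t
    mrca-across {a = a} {l = l} (node _ _ l#r) a∈l b∈r
      rewrite contains-∉ (λ b∈l → l#r b∈l b∈r) | ∧-comm (contains a l) false
            | contains-∉ (l#r a∈l) = refl

    mrca-sym : (T : Tree A n) (a b : Fin n) → mrca T a b ≡ mrca T b a
    mrca-sym (leaf _)     a b = refl
    mrca-sym (node t l r) a b
      rewrite ∧-comm (contains a l) (contains b l) | ∧-comm (contains a r) (contains b r)
            | mrca-sym l a b | mrca-sym r a b = refl

    mrca-self : {T : Tree A n} → UniqueLeaves T → a ∈ᵀ T → mrca T a a ≡ nothing
    mrca-self _                              here        = refl
    mrca-self {T = node _ _ r} (node ul _ _) (left a∈l)  = trans (mrca-left {r = r} a∈l a∈l) (mrca-self ul a∈l)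
    mrca-self u@(node _ ur _)                (right a∈r) = trans (mrca-right u a∈r a∈r) (mrca-self ur a∈r)

    mrca-internal : {t : A} (T : Tree A n) → mrca T a b ≡ just t → t ∈ internals T
    mrca-internal {a = a} {b = b} (node s l r) e with contains a l ∧ contains b l | contains a r ∧ contains b r
    ... | true  | _     = there (∈-++⁺ˡ (mrca-internal l e))
    ... | false | true  = there (∈-++⁺ʳ (internals l) (mrca-internal r e))
    ... | false | false = here (sym (just-injective e))

    mrca-relabel : {f : Fin n → Fin n} → Injective _≡_ _≡_ f → (T : Tree A n) →
                   mrca (relabel f T) (f a) (f b) ≡ mrca T a b
    mrca-relabel                 inj (leaf _)     = refl
    mrca-relabel {a = a} {b = b} inj (node t l r)
      rewrite contains-relabel {a = a} inj l | contains-relabel {a = b} inj l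
            | contains-relabel {a = a} inj r | contains-relabel {a = b} inj r
            | mrca-relabel {a = a} {b = b} inj l | mrca-relabel {a = a} {b = b} inj r = refl

  mrca-across′ : {t : A} {l r : Tree A n} → UniqueLeaves (node t l r) → a ∈ᵀ r → b ∈ᵀ l →
                 mrca (node t l r) a b ≡ just t
  mrca-across′ {a = a} {b = b} {l = l} {r} u a∈r b∈l =
    trans (mrca-sym (node _ l r) a b) (mrca-across u b∈l a∈r)

  mrca-nothing : {T : Tree A n} → UniqueLeaves T → a ∈ᵀ T → b ∈ᵀ T → mrca T a b ≡ nothing → a ≡ b
  mrca-nothing _               here        here        _ = refl
  mrca-nothing (node ul _ _)   (left a∈l)  (left b∈l)  e =
    mrca-nothing ul a∈l b∈l (trans (sym (mrca-left a∈l b∈l)) e)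
  mrca-nothing u@(node _ ur _) (right a∈r) (right b∈r) e =
    mrca-nothing ur a∈r b∈r (trans (sym (mrca-right u a∈r b∈r)) e)
  mrca-nothing u (left a∈l)  (right b∈r) e with () ← trans (sym (mrca-across u a∈l b∈r)) e
  mrca-nothing u (right a∈r) (left b∈l)  e with () ← trans (sym (mrca-across′ u a∈r b∈l)) e

  mrca-just : {T : Tree A n} → UniqueLeaves T → a ∈ᵀ T → b ∈ᵀ T → a ≢ b → ∃ λ t → mrca T a b ≡ just t
  mrca-just {a = a} {b = b} {T = T} u a∈T b∈T a≢b with mrca T a b in e
  ... | nothing = contradiction (mrca-nothing u a∈T b∈T e) a≢b
  ... | just t  = t , refl

  mrca-onto : {t : A} {T : Tree A n} → UniqueLeaves T → t ∈ internals T →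
              ∃₂ λ a b → a ∈ᵀ T × b ∈ᵀ T × mrca T a b ≡ just t
  mrca-onto {T = node s l r} u (here refl) with someLeaf l | someLeaf r
  ... | a , a∈l | b , b∈r = a , b , left a∈l , right b∈r , mrca-across u a∈l b∈r
  mrca-onto {T = node s l r} u@(node ul ur _) (there t∈) with ∈-++⁻ (internals l) t∈
  ... | inj₁ t∈l = let a , b , a∈l , b∈l , e = mrca-onto ul t∈l
                   in  a , b , left a∈l , left b∈l , trans (mrca-left a∈l b∈l) e
  ... | inj₂ t∈r = let a , b , a∈r , b∈r , e = mrca-onto ur t∈r
                   in  a , b , right a∈r , right b∈r , trans (mrca-right u a∈r b∈r) e

  swap-∈ : {t : A} {l r : Tree A n} → a ∈ᵀ node t l r → a ∈ᵀ node t r l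
  swap-∈ (left a∈l)  = right a∈l
  swap-∈ (right a∈r) = left a∈r

  swap-uniqueLeaves : {t : A} {l r : Tree A n} → UniqueLeaves (node t l r) → UniqueLeaves (node t r l)
  swap-uniqueLeaves (node ul ur l#r) = node ur ul (λ a∈r a∈l → l#r a∈l a∈r)

  mrca-swap : {t : A} {l r : Tree A n} → UniqueLeaves (node t l r) →
              a ∈ᵀ node t l r → b ∈ᵀ node t l r → mrca (node t r l) a b ≡ mrca (node t l r) a b
  mrca-swap u (left a)  (left b)  = trans (mrca-right (swap-uniqueLeaves u) a b) (sym (mrca-left a b))
  mrca-swap u (right a) (right b) = trans (mrca-left a b) (sym (mrca-right u a b))
  mrca-swap u (left a)  (right b) = trans (mrca-across′ (swap-uniqueLeaves u) a b) (sym (mrca-across u a b))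
  mrca-swap u (right a) (left b)  = trans (mrca-across (swap-uniqueLeaves u) a b) (sym (mrca-across′ u a b))

  data Heap (_≺_ : A → A → Set) : Tree A n → Set where
    leaf : Heap _≺_ (leaf a)
    node : ∀ {t l r} → All (_≺ t) (internals l) → All (_≺ t) (internals r) →
           Heap _≺_ l → Heap _≺_ r → Heap _≺_ (node t l r)

  relabel-heap : {_≺_ : A → A → Set} {f : Fin n → Fin n} (T : Tree A n) →
                 Heap _≺_ T → Heap _≺_ (relabel f T)
  relabel-heap (leaf _)     leaf               = leaf
  relabel-heap (node _ l r) (node hl hr Hl Hr) =
    node (subst (All _) (sym (internals-relabel l)) hl) (subst (All _) (sym (internals-relabel r)) hr)
         (relabel-heap l Hl) (relabel-heap r Hr)

  swap-heap : {_≺_ : A → A → Set} {t : A} {l r : Tree A n} → Heap _≺_ (node t l r) → Heap _≺_ (node t r l)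
  swap-heap (node hl hr Hl Hr) = node hr hl Hr Hl

-- Heights in ranked trees

module _ {n : ℕ} where

  height : Tree ℕ n → Fin n → Fin n → ℕ
  height Z a b = maybe suc 0 (mrca Z a b)

  height-suc : {Z : Tree ℕ n} {j : ℕ} → height Z a b ≡ suc j → mrca Z a b ≡ just j
  height-suc {a = a} {b = b} {Z = Z} e with mrca Z a b
  height-suc refl | just _ = refl

  height-self : {Z : Tree ℕ n} → UniqueLeaves Z → a ∈ᵀ Z → height Z a a ≡ 0
  height-self u a∈Z = cong (maybe suc 0) (mrca-self u a∈Z)

  height-relabel : {f : Fin n → Fin n} → Injective _≡_ _≡_ f → (Z : Tree ℕ n) →
                   height (relabel f Z) (f a) (f b) ≡ height Z a b
  height-relabel f-injective Z = cong (maybe suc 0) (mrca-relabel f-injective Z)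

  height-≤ : {Z : Tree ℕ n} {K : ℕ} → All (_< K) (internals Z) → height Z a b ≤ K
  height-≤ {a = a} {b = b} {Z = Z} below with mrca Z a b in e
  ... | nothing = z≤n
  ... | just _  = All.lookup below (mrca-internal Z e)

  module _ {k : ℕ} {l r : Tree ℕ n} where

    height-left : a ∈ᵀ l → b ∈ᵀ l → height (node k l r) a b ≡ height l a b
    height-left a∈l b∈l = cong (maybe suc 0) (mrca-left a∈l b∈l)

    height-right : UniqueLeaves (node k l r) → a ∈ᵀ r → b ∈ᵀ r → height (node k l r) a b ≡ height r a b
    height-right u a∈r b∈r = cong (maybe suc 0) (mrca-right u a∈r b∈r)

    height-across : UniqueLeaves (node k l r) → a ∈ᵀ l → b ∈ᵀ r → height (node k l r) a b ≡ suc k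
    height-across u a∈l b∈r = cong (maybe suc 0) (mrca-across u a∈l b∈r)

    height-across′ : UniqueLeaves (node k l r) → a ∈ᵀ r → b ∈ᵀ l → height (node k l r) a b ≡ suc k
    height-across′ u a∈r b∈l = cong (maybe suc 0) (mrca-across′ u a∈r b∈l)

    height-root : Heap _<_ (node k l r) → height (node k l r) a b ≤ suc k
    height-root (node hl hr _ _) =
      height-≤ (≤-refl ∷ ++⁺ (All.map m≤n⇒m≤1+n hl) (All.map m≤n⇒m≤1+n hr))

    height-≤-across : Heap _<_ (node k l r) → height (node k l r) x y ≡ suc k →
                      height (node k l r) a b ≤ height (node k l r) x y
    height-≤-across h e = subst (_ ≤_) (sym e) (height-root h)

    height-left-≤ : Heap _<_ (node k l r) → a ∈ᵀ l → b ∈ᵀ l → height (node k l r) a b ≤ k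
    height-left-≤ (node hl _ _ _) a∈l b∈l = subst (_≤ k) (sym (height-left a∈l b∈l)) (height-≤ hl)

    height-right-≤ : UniqueLeaves (node k l r) → Heap _<_ (node k l r) → a ∈ᵀ r → b ∈ᵀ r →
                     height (node k l r) a b ≤ k
    height-right-≤ u (node _ hr _ _) a∈r b∈r = subst (_≤ k) (sym (height-right u a∈r b∈r)) (height-≤ hr)

  height-ultrametric : {Z : Tree ℕ n} → UniqueLeaves Z → Heap _<_ Z → a ∈ᵀ Z → b ∈ᵀ Z → c ∈ᵀ Z →
                       height Z a c ≤ height Z a b ⊔ height Z b c
  height-ultrametric _ _ here here here = m≤m⊔n _ _
  height-ultrametric (node ul _ _) (node _ _ Hl _) (left a) (left b) (left c) =
    subst₂ _≤_ (sym (height-left a c)) (sym (cong₂ _⊔_ (height-left a b) (height-left b c)))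
               (height-ultrametric ul Hl a b c)
  height-ultrametric u@(node _ ur _) (node _ _ _ Hr) (right a) (right b) (right c) =
    subst₂ _≤_ (sym (height-right u a c)) (sym (cong₂ _⊔_ (height-right u a b) (height-right u b c)))
               (height-ultrametric ur Hr a b c)
  height-ultrametric u h (left a)  (left b)  (right c) =
    m≤n⇒m≤o⊔n _ (height-≤-across h (height-across u b c))
  height-ultrametric u h (left a)  (right b) (left c)  =
    m≤n⇒m≤n⊔o _ (height-≤-across h (height-across u a b))
  height-ultrametric u h (left a)  (right b) (right c) =
    m≤n⇒m≤n⊔o _ (height-≤-across h (height-across u a b))
  height-ultrametric u h (right a) (left b)  (left c)  =
    m≤n⇒m≤n⊔o _ (height-≤-across h (height-across′ u a b))
  height-ultrametric u h (right a) (left b)  (right c) =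
    m≤n⇒m≤n⊔o _ (height-≤-across h (height-across′ u a b))
  height-ultrametric u h (right a) (right b) (left c)  =
    m≤n⇒m≤o⊔n _ (height-≤-across h (height-across′ u b c))

  height-path : {Z : Tree ℕ n} → UniqueLeaves Z → Heap _<_ Z →
                a ∈ᵀ Z → b ∈ᵀ Z → x ∈ᵀ Z → y ∈ᵀ Z →
                height Z a b ≤ height Z a x ⊔ (height Z x y ⊔ height Z y b)
  height-path u h a b x y =
    ≤-trans (height-ultrametric u h a x b) (⊔-monoʳ-≤ _ (height-ultrametric u h x y b))

  data MrcaPosition (k : ℕ) (l r : Tree ℕ n) (j : ℕ) (a b : Fin n) : Set where
    inLeft  : a ∈ᵀ l → b ∈ᵀ l → mrca l a b ≡ just j → MrcaPosition k l r j a b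
    inRight : a ∈ᵀ r → b ∈ᵀ r → mrca r a b ≡ just j → MrcaPosition k l r j a b
    atRoot  : k ≡ j → (a ∈ᵀ l × b ∈ᵀ r) ⊎ (a ∈ᵀ r × b ∈ᵀ l) → MrcaPosition k l r j a b

  mrcaPosition : {k j : ℕ} {l r : Tree ℕ n} → UniqueLeaves (node k l r) → a ∈ᵀ node k l r → b ∈ᵀ node k l r →
                 mrca (node k l r) a b ≡ just j → MrcaPosition k l r j a b
  mrcaPosition u (left a)  (left b)  e = inLeft a b (trans (sym (mrca-left a b)) e)
  mrcaPosition u (right a) (right b) e = inRight a b (trans (sym (mrca-right u a b)) e)
  mrcaPosition u (left a)  (right b) e =
    atRoot (just-injective (trans (sym (mrca-across u a b)) e)) (inj₁ (a , b))
  mrcaPosition u (right a) (left b)  e =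
    atRoot (just-injective (trans (sym (mrca-across′ u a b)) e)) (inj₂ (a , b))

  height-binary : {Z : Tree ℕ n} {j : ℕ} → UniqueLeaves Z → Heap _<_ Z → Unique (internals Z) →
                  a ∈ᵀ Z → b ∈ᵀ Z → x ∈ᵀ Z → y ∈ᵀ Z → mrca Z a b ≡ just j → mrca Z x y ≡ just j →
                  (height Z a x ≤ j × height Z y b ≤ j) ⊎ (height Z a y ≤ j × height Z x b ≤ j)
  height-binary {Z = leaf _} _ _ _ here here here here e _ with () ← trans (sym (mrca-self leaf here)) e
  height-binary {Z = node k l r} u@(node ul ur _) h@(node hl hr Hl Hr) (_ ∷ U) a b x y e e′
    with Unique-++⁻ (internals l) U | mrcaPosition u a b e | mrcaPosition u x y e′
  ... | Ul , _ , _ | inLeft a b e | inLeft x y e′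
    rewrite height-left {k = k} {r = r} a x | height-left {k = k} {r = r} y b
          | height-left {k = k} {r = r} a y | height-left {k = k} {r = r} x b
    = height-binary ul Hl Ul a b x y e e′
  ... | _ , Ur , _ | inRight a b e | inRight x y e′
    rewrite height-right u a x | height-right u y b | height-right u a y | height-right u x b
    = height-binary ur Hr Ur a b x y e e′
  ... | _ , _ , l#r | inLeft _ _ e  | inRight _ _ e′ = ⊥-elim (l#r (mrca-internal l e , mrca-internal r e′))
  ... | _ , _ , l#r | inRight _ _ e | inLeft _ _ e′  = ⊥-elim (l#r (mrca-internal l e′ , mrca-internal r e))
  ... | _ | inLeft _ _ e  | atRoot refl _  = ⊥-elim (<-irrefl refl (All.lookup hl (mrca-internal l e)))
  ... | _ | inRight _ _ e | atRoot refl _  = ⊥-elim (<-irrefl refl (All.lookup hr (mrca-internal r e)))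
  ... | _ | atRoot refl _ | inLeft _ _ e′  = ⊥-elim (<-irrefl refl (All.lookup hl (mrca-internal l e′)))
  ... | _ | atRoot refl _ | inRight _ _ e′ = ⊥-elim (<-irrefl refl (All.lookup hr (mrca-internal r e′)))
  ... | _ | atRoot _ (inj₁ (a , b)) | atRoot refl (inj₁ (x , y)) =
    inj₁ (height-left-≤ h a x , height-right-≤ u h y b)
  ... | _ | atRoot _ (inj₁ (a , b)) | atRoot refl (inj₂ (x , y)) =
    inj₂ (height-left-≤ h a y , height-right-≤ u h x b)
  ... | _ | atRoot _ (inj₂ (a , b)) | atRoot refl (inj₁ (x , y)) =
    inj₂ (height-right-≤ u h a y , height-left-≤ h x b)
  ... | _ | atRoot _ (inj₂ (a , b)) | atRoot refl (inj₂ (x , y)) =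
    inj₁ (height-right-≤ u h a x , height-left-≤ h y b)

-- Comparing ranked trees through their heights

record IsRankedTree {n : ℕ} (Z : Tree ℕ n) : Set where
  field
    complete      : ∀ a → a ∈ᵀ Z
    unique-leaves : UniqueLeaves Z
    heap          : Heap _<_ Z
    unique-ranks  : Unique (internals Z)

module _ {n : ℕ} {X Y : Tree ℕ n} (X-ranked : IsRankedTree X) (Y-ranked : IsRankedTree Y)
         (X≤Y : ∀ a b → height X a b ≤ height Y a b)
         (X⊆Y : ∀ {j} → j ∈ internals X → j ∈ internals Y) where

  private
    module X = IsRankedTree X-ranked
    module Y = IsRankedTree Y-ranked

    Agree : ℕ → Set
    Agree m = ∀ a b → height X a b ≡ m → height Y a b ≡ m

    module _ {j : ℕ} (ih : ∀ {m} → m < suc j → Agree m) where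

      agree-below : ∀ {p q} → height X p q ≤ j → height Y p q ≤ suc j
      agree-below {p} {q} le = ≤-trans (≤-reflexive (ih (s≤s le) p q refl)) (m≤n⇒m≤1+n le)

      agree-at-witness : mrca Y x y ≡ just j → mrca X x y ≡ just j
      agree-at-witness {x = x} {y = y} exy
        with m≤n⇒m<n∨m≡n (subst (height X x y ≤_) (cong (maybe suc 0) exy) (X≤Y x y))
      ... | inj₁ lt = contradiction (trans (sym (ih lt x y refl)) (cong (maybe suc 0) exy)) (<⇒≢ lt)
      ... | inj₂ eq = height-suc eq

      agree-through : height X a x ≤ j → height X y b ≤ j → mrca Y x y ≡ just j → height Y a b ≤ suc j
      agree-through {a = a} {x = x} {y = y} {b = b} ax yb exy =
        ≤-trans (height-path Y.unique-leaves Y.heap (Y.complete a) (Y.complete b) (Y.complete x) (Y.complete y))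
                (⊔-lub (agree-below ax) (⊔-lub (≤-reflexive (cong (maybe suc 0) exy)) (agree-below yb)))

      agree-≤ : mrca X a b ≡ just j → height Y a b ≤ suc j
      agree-≤ {a = a} {b = b} eab with mrca-onto Y.unique-leaves (X⊆Y (mrca-internal X eab))
      ... | x , y , _ , _ , exy
        with height-binary X.unique-leaves X.heap X.unique-ranks (X.complete a) (X.complete b)
                           (X.complete x) (X.complete y) eab (agree-at-witness exy)
      ... | inj₁ (ax , yb) = agree-through ax yb exy
      ... | inj₂ (ay , xb) = agree-through ay xb (trans (mrca-sym Y y x) exy)

    agree : ∀ m → (∀ {m′} → m′ < m → Agree m′) → Agree m
    agree m ih a b e with mrca X a b in eab
    agree _ ih a b refl | nothing with refl ← mrca-nothing X.unique-leaves (X.complete a) (X.complete b) eab =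
      height-self Y.unique-leaves (Y.complete a)
    agree _ ih a b refl | just j =
      ≤-antisym (agree-≤ ih eab) (subst (_≤ height Y a b) (cong (maybe suc 0) eab) (X≤Y a b))

  heights-agree : ∀ a b → height X a b ≡ height Y a b
  heights-agree a b = sym (<-rec Agree agree (height X a b) a b refl)

module _ {n : ℕ} where

  record Matching (X Y : Tree ℕ n) : Set where
    constructor matching
    field
      leaves⊆ : ∀ {a} → a ∈ᵀ X → a ∈ᵀ Y
      leaves⊇ : ∀ {a} → a ∈ᵀ Y → a ∈ᵀ X
      heights : ∀ {a b} → a ∈ᵀ X → b ∈ᵀ X → height X a b ≡ height Y a b

  open Matching

  clade-left : {k : ℕ} {l r : Tree ℕ n} → UniqueLeaves (node k l r) →
               a ∈ᵀ l → b ∈ᵀ node k l r → height (node k l r) a b ≤ k → b ∈ᵀ l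
  clade-left u a∈l (left b∈l)  _  = b∈l
  clade-left u a∈l (right b∈r) ab = ⊥-elim (1+n≰n (subst (_≤ _) (height-across u a∈l b∈r) ab))

  swap-matching : {X : Tree ℕ n} {k : ℕ} {l r : Tree ℕ n} → UniqueLeaves (node k l r) →
                  Matching X (node k l r) → Matching X (node k r l)
  swap-matching u m = matching (swap-∈ ∘ leaves⊆ m) (leaves⊇ m ∘ swap-∈)
    (λ a b → trans (heights m a b) (sym (cong (maybe suc 0) (mrca-swap u (leaves⊆ m a) (leaves⊆ m b)))))

  matching⇒root≡ : {k k′ : ℕ} {X₁ X₂ Y₁ Y₂ : Tree ℕ n} →
                   UniqueLeaves (node k X₁ X₂) → Heap _<_ (node k X₁ X₂) →
                   UniqueLeaves (node k′ Y₁ Y₂) → Heap _<_ (node k′ Y₁ Y₂) →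
                   Matching (node k X₁ X₂) (node k′ Y₁ Y₂) → k ≡ k′
  matching⇒root≡ {k} {k′} {X₁} {X₂} {Y₁} {Y₂} uX hX uY hY m
    with someLeaf X₁ | someLeaf X₂ | someLeaf Y₁ | someLeaf Y₂
  ... | a , a∈X₁ | b , b∈X₂ | c , c∈Y₁ | d , d∈Y₂ = suc-injective (≤-antisym k≤k′ k′≤k)
    where
    k≤k′ : suc k ≤ suc k′
    k≤k′ = subst (_≤ suc k′)
                 (trans (sym (heights m (left a∈X₁) (right b∈X₂))) (height-across uX a∈X₁ b∈X₂))
                 (height-root hY)

    k′≤k : suc k′ ≤ suc k
    k′≤k = subst (_≤ suc k)
                 (trans (heights m (leaves⊇ m (left c∈Y₁)) (leaves⊇ m (right d∈Y₂)))
                        (height-across uY c∈Y₁ d∈Y₂))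
                 (height-root hX)

  children-matching : {k : ℕ} {X₁ X₂ Y₁ Y₂ : Tree ℕ n} →
                      UniqueLeaves (node k X₁ X₂) → Heap _<_ (node k X₁ X₂) →
                      UniqueLeaves (node k Y₁ Y₂) → Heap _<_ (node k Y₁ Y₂) →
                      Matching (node k X₁ X₂) (node k Y₁ Y₂) → a ∈ᵀ X₁ → a ∈ᵀ Y₁ →
                      Matching X₁ Y₁ × Matching X₂ Y₂
  children-matching {k = k} {X₁} {X₂} {Y₁} {Y₂} uX@(node _ _ X₁#X₂) hX uY@(node _ _ Y₁#Y₂) hY m
                    a∈X₁ a∈Y₁ =
    matching X₁⊆Y₁ Y₁⊆X₁ heights₁ , matching X₂⊆Y₂ Y₂⊆X₂ heights₂
    where
    X₁⊆Y₁ : ∀ {z} → z ∈ᵀ X₁ → z ∈ᵀ Y₁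
    X₁⊆Y₁ z = clade-left uY a∈Y₁ (leaves⊆ m (left z))
                (subst (_≤ k) (heights m (left a∈X₁) (left z)) (height-left-≤ hX a∈X₁ z))

    Y₁⊆X₁ : ∀ {z} → z ∈ᵀ Y₁ → z ∈ᵀ X₁
    Y₁⊆X₁ z = clade-left uX a∈X₁ (leaves⊇ m (left z))
                (subst (_≤ k) (sym (heights m (left a∈X₁) (leaves⊇ m (left z))))
                              (height-left-≤ hY a∈Y₁ z))

    X₂⊆Y₂ : ∀ {z} → z ∈ᵀ X₂ → z ∈ᵀ Y₂
    X₂⊆Y₂ z with leaves⊆ m (right z)
    ... | left z∈Y₁  = ⊥-elim (X₁#X₂ (Y₁⊆X₁ z∈Y₁) z)
    ... | right z∈Y₂ = z∈Y₂

    Y₂⊆X₂ : ∀ {z} → z ∈ᵀ Y₂ → z ∈ᵀ X₂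
    Y₂⊆X₂ z with leaves⊇ m (right z)
    ... | left z∈X₁  = ⊥-elim (Y₁#Y₂ (X₁⊆Y₁ z∈X₁) z)
    ... | right z∈X₂ = z∈X₂

    heights₁ : ∀ {a b} → a ∈ᵀ X₁ → b ∈ᵀ X₁ → height X₁ a b ≡ height Y₁ a b
    heights₁ a b = trans (sym (height-left a b))
                         (trans (heights m (left a) (left b)) (height-left (X₁⊆Y₁ a) (X₁⊆Y₁ b)))

    heights₂ : ∀ {a b} → a ∈ᵀ X₂ → b ∈ᵀ X₂ → height X₂ a b ≡ height Y₂ a b
    heights₂ a b = trans (sym (height-right uX a b))
                         (trans (heights m (right a) (right b)) (height-right uY (X₂⊆Y₂ a) (X₂⊆Y₂ b)))

  matching⇒≅ : {X Y : Tree ℕ n} → UniqueLeaves X → Heap _<_ X → UniqueLeaves Y → Heap _<_ Y →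
               Matching X Y → X ≅ Y
  matching⇒≅ {X = leaf a} {leaf _} _ _ _ _ m with leaves⊆ m here
  ... | here = leaf≅ a
  matching⇒≅ {X = leaf _} {node _ Y₁ Y₂} _ _ (node _ _ Y₁#Y₂) _ m with someLeaf Y₁ | someLeaf Y₂
  ... | _ , c∈Y₁ | _ , d∈Y₂ with leaves⊇ m (left c∈Y₁) | leaves⊇ m (right d∈Y₂)
  ... | here | here = ⊥-elim (Y₁#Y₂ c∈Y₁ d∈Y₂)
  matching⇒≅ {X = node _ X₁ X₂} {leaf _} (node _ _ X₁#X₂) _ _ _ m with someLeaf X₁ | someLeaf X₂
  ... | _ , a∈X₁ | _ , b∈X₂ with leaves⊆ m (left a∈X₁) | leaves⊆ m (right b∈X₂)
  ... | here | here = ⊥-elim (X₁#X₂ a∈X₁ b∈X₂)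
  matching⇒≅ {X = node k X₁ X₂} {node _ Y₁ Y₂} uX@(node uX₁ uX₂ _) hX@(node _ _ hX₁ hX₂)
                                              uY@(node uY₁ uY₂ _) hY@(node _ _ hY₁ hY₂) m
    with matching⇒root≡ uX hX uY hY m | someLeaf X₁
  ... | refl | a , a∈X₁ with leaves⊆ m (left a∈X₁)
  ... | left a∈Y₁ =
    let m₁ , m₂ = children-matching uX hX uY hY m a∈X₁ a∈Y₁
    in  node≅ k (matching⇒≅ uX₁ hX₁ uY₁ hY₁ m₁) (matching⇒≅ uX₂ hX₂ uY₂ hY₂ m₂)
  ... | right a∈Y₂ =
    let m₁ , m₂ = children-matching uX hX (swap-uniqueLeaves uY) (swap-heap hY) (swap-matching uY m)
                                    a∈X₁ a∈Y₂
    in  swap≅ k (matching⇒≅ uX₁ hX₁ uY₂ hY₂ m₁) (matching⇒≅ uX₂ hX₂ uY₁ hY₁ m₂)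

  heights⇒≅ : {X Y : Tree ℕ n} → IsRankedTree X → IsRankedTree Y →
              (∀ a b → height X a b ≡ height Y a b) → X ≅ Y
  heights⇒≅ X-ranked Y-ranked X≡Y =
    matching⇒≅ X.unique-leaves X.heap Y.unique-leaves Y.heap
               (matching (λ {a} _ → Y.complete a) (λ {a} _ → X.complete a) (λ {a} {b} _ _ → X≡Y a b))
    where
    module X = IsRankedTree X-ranked
    module Y = IsRankedTree Y-ranked

-- Ranks of times

≤∧≢⇒< : u ℚ.≤ v → u ≢ v → u ℚ.< v
≤∧≢⇒< {u = u} {v = v} u≤v u≢v with ℚₚ.<-cmp u v
... | tri< u<v _ _ = u<v
... | tri≈ _ u≡v _ = contradiction u≡v u≢v
... | tri> _ _ v<u = contradiction (ℚₚ.≤-<-trans u≤v v<u) (ℚₚ.<-irrefl refl)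

double-cancel-≤ : t ℚ.+ t ℚ.≤ u ℚ.+ u → t ℚ.≤ u
double-cancel-≤ {t = t} {u = u} le with t ℚₚ.≤? u
... | yes t≤u = t≤u
... | no t≰u  = contradiction (ℚₚ.≤-<-trans le (ℚₚ.+-mono-< u<t u<t)) (ℚₚ.<-irrefl refl)
  where
  u<t : u ℚ.< t
  u<t = ℚₚ.≰⇒> t≰u

countBelow : List ℚ → ℚ → ℕ
countBelow xs t = length (filter (ℚ._<? t) xs)

countBelow-↭ : xs ↭ ys → countBelow xs t ≡ countBelow ys t
countBelow-↭ {t = t} xs↭ys = ↭-length (filter-↭ (ℚ._<? t) xs↭ys)

countBelow-mono : u ℚ.≤ v → countBelow xs u ≤ countBelow xs v
countBelow-mono {u = u} {v = v} {xs = xs} u≤v =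
  length-mono-≤ (filter⁺ (ℚ._<? u) (ℚ._<? v) (λ { refl w<u → ℚₚ.<-≤-trans w<u u≤v })
                         (⊆-refl {x = xs}))

countBelow-accept : {x : ℚ} → x ℚ.< t → countBelow (x ∷ xs) t ≡ suc (countBelow xs t)
countBelow-accept {t = t} x<t = cong length (filter-accept (ℚ._<? t) x<t)

countBelow-reject : {x : ℚ} → ¬ x ℚ.< t → countBelow (x ∷ xs) t ≡ countBelow xs t
countBelow-reject {t = t} x≮t = cong length (filter-reject (ℚ._<? t) x≮t)

countBelow-least : All (t ℚ.<_) xs → countBelow (t ∷ xs) t ≡ 0
countBelow-least {t = t} t<xs =
  cong length (filter-none (ℚ._<? t) (ℚₚ.<-irrefl refl ∷ All.map ℚₚ.<-asym t<xs))

countBelow-strict : u ∈ xs → u ℚ.< v → countBelow xs u < countBelow xs v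
countBelow-strict {u = u} {xs = _ ∷ xs} {v = v} (here refl) u<v
  rewrite countBelow-reject {t = u} {xs = xs} (ℚₚ.<-irrefl refl) | countBelow-accept {t = v} {xs = xs} u<v
  = s≤s (countBelow-mono {xs = xs} (ℚₚ.<⇒≤ u<v))
countBelow-strict {u = u} {xs = x ∷ xs} {v = v} (there u∈xs) u<v with x ℚ.<? u | x ℚ.<? v
... | yes x<u | _
  rewrite countBelow-accept {t = u} {xs = xs} x<u | countBelow-accept {t = v} {xs = xs} (ℚₚ.<-trans x<u u<v)
  = s≤s (countBelow-strict u∈xs u<v)
... | no x≮u | yes x<v
  rewrite countBelow-reject {t = u} {xs = xs} x≮u | countBelow-accept {t = v} {xs = xs} x<v
  = m≤n⇒m≤1+n (countBelow-strict u∈xs u<v)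
... | no x≮u | no x≮v
  rewrite countBelow-reject {t = u} {xs = xs} x≮u | countBelow-reject {t = v} {xs = xs} x≮v
  = countBelow-strict u∈xs u<v

countBelow-injective : u ∈ xs → v ∈ xs → countBelow xs u ≡ countBelow xs v → u ≡ v
countBelow-injective {u = u} {v = v} u∈ v∈ e with ℚₚ.<-cmp u v
... | tri< u<v _ _ = contradiction e (<⇒≢ (countBelow-strict u∈ u<v))
... | tri≈ _ u≡v _ = u≡v
... | tri> _ _ v<u = contradiction (sym e) (<⇒≢ (countBelow-strict v∈ v<u))

module _ {n : ℕ} where

  rankBy : Tree ℚ n → Tree ℚ n → Tree ℕ n
  rankBy T (leaf a)     = leaf a
  rankBy T (node t l r) = node (rankIn T t) (rankBy T l) (rankBy T r)

  private
    children : {A : Set} → Tree A n → Tree A n × Tree A n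
    children (leaf a)     = leaf a , leaf a
    children (node _ l r) = l , r

  -- `rankedTopology` recurses through a local function that cannot be named here. The underscore
  -- is solved to it by the with-abstraction in `rankedTopology-children`, which needs the stuck
  -- form `rankBy T S` on the right.
  mutual
    rankedTopology-local : (T S : Tree ℚ n) → _ ≡ rankBy T S
    rankedTopology-local T (leaf a)     = refl
    rankedTopology-local T (node t l r) =
      cong₂ (node (rankIn T t)) (rankedTopology-local T l) (rankedTopology-local T r)

    rankedTopology-children : (t : ℚ) (l r : Tree ℚ n) →
                              children (rankedTopology (node t l r)) ≡ (rankBy (node t l r) l , rankBy (node t l r) r)
    rankedTopology-children t l r with node t l r
    ... | T = cong₂ _,_ (rankedTopology-local T l) (rankedTopology-local T r)

  rankedTopology≡rankBy : (T : Tree ℚ n) → rankedTopology T ≡ rankBy T T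
  rankedTopology≡rankBy (leaf a)     = refl
  rankedTopology≡rankBy (node t l r) =
    cong₂ (node _) (cong proj₁ (rankedTopology-children t l r)) (cong proj₂ (rankedTopology-children t l r))

  module _ {T : Tree ℚ n} where

    rankBy-∈ : {S : Tree ℚ n} → a ∈ᵀ S → a ∈ᵀ rankBy T S
    rankBy-∈ here        = here
    rankBy-∈ (left a∈l)  = left (rankBy-∈ a∈l)
    rankBy-∈ (right a∈r) = right (rankBy-∈ a∈r)

    rankBy-∈⁻ : {S : Tree ℚ n} → a ∈ᵀ rankBy T S → a ∈ᵀ S
    rankBy-∈⁻ {S = leaf _}     here        = here
    rankBy-∈⁻ {S = node _ _ _} (left a∈l)  = left (rankBy-∈⁻ a∈l)
    rankBy-∈⁻ {S = node _ _ _} (right a∈r) = right (rankBy-∈⁻ a∈r)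

    rankBy-uniqueLeaves : {S : Tree ℚ n} → UniqueLeaves S → UniqueLeaves (rankBy T S)
    rankBy-uniqueLeaves leaf             = leaf
    rankBy-uniqueLeaves (node ul ur l#r) =
      node (rankBy-uniqueLeaves ul) (rankBy-uniqueLeaves ur)
           (λ a∈l a∈r → l#r (rankBy-∈⁻ a∈l) (rankBy-∈⁻ a∈r))

    contains-rankBy : (S : Tree ℚ n) → contains a (rankBy T S) ≡ contains a S
    contains-rankBy (leaf _)     = refl
    contains-rankBy (node _ l r) = cong₂ _∨_ (contains-rankBy l) (contains-rankBy r)

    internals-rankBy : (S : Tree ℚ n) → internals (rankBy T S) ≡ map (rankIn T) (internals S)
    internals-rankBy (leaf _)     = refl
    internals-rankBy (node t l r) =
      cong (rankIn T t ∷_) (trans (cong₂ _++_ (internals-rankBy l) (internals-rankBy r))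
                                  (sym (map-++ (rankIn T) (internals l) (internals r))))

    rankBy-heap : (S : Tree ℚ n) → Heap ℚ._<_ S → (∀ {u} → u ∈ internals S → u ∈ internals T) →
                  Heap _<_ (rankBy T S)
    rankBy-heap (leaf _)     leaf               _   = leaf
    rankBy-heap (node t l r) (node hl hr Hl Hr) S⊆T =
      node (ranks-below l (λ u∈l → there (∈-++⁺ˡ u∈l)) hl)
           (ranks-below r (λ u∈r → there (∈-++⁺ʳ (internals l) u∈r)) hr)
           (rankBy-heap l Hl (λ u∈l → S⊆T (there (∈-++⁺ˡ u∈l))))
           (rankBy-heap r Hr (λ u∈r → S⊆T (there (∈-++⁺ʳ (internals l) u∈r))))
      where
      ranks-below : (C : Tree ℚ n) → (∀ {u} → u ∈ internals C → u ∈ internals (node t l r)) →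
                    All (ℚ._< t) (internals C) → All (_< rankIn T t) (internals (rankBy T C))
      ranks-below C C⊆S below = subst (All _) (sym (internals-rankBy C))
        (map⁺ (All.tabulate (λ u∈C → countBelow-strict (S⊆T (C⊆S u∈C)) (All.lookup below u∈C))))

    opaque
      unfolding mrca

      mrca-rankBy : (S : Tree ℚ n) → mrca (rankBy T S) a b ≡ Maybe.map (rankIn T) (mrca S a b)
      mrca-rankBy                 (leaf _)     = refl
      mrca-rankBy {a = a} {b = b} (node t l r)
        rewrite contains-rankBy {a = a} l | contains-rankBy {a = b} l
              | contains-rankBy {a = a} r | contains-rankBy {a = b} r
        with contains a l ∧ contains b l | contains a r ∧ contains b r
      ... | true  | _     = mrca-rankBy l
      ... | false | true  = mrca-rankBy r
      ... | false | false = refl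

    height-rankBy : {S : Tree ℚ n} {t : ℚ} → mrca S a b ≡ just t →
                    height (rankBy T S) a b ≡ suc (rankIn T t)
    height-rankBy {S = S} e = cong (maybe suc 0) (trans (mrca-rankBy S) (cong (Maybe.map (rankIn T)) e))

  opaque
    unfolding mrca

    dist-mrca : (T : Tree ℚ n) (a b : Fin n) → dist T a b ≡ maybe (λ t → t ℚ.+ t) 0ℚ (mrca T a b)
    dist-mrca (leaf _)     a b = refl
    dist-mrca (node t l r) a b with contains a l ∧ contains b l | contains a r ∧ contains b r
    ... | true  | _     = dist-mrca l a b
    ... | false | true  = dist-mrca r a b
    ... | false | false = refl

  mrca-≤-of-dist : {S T : Tree ℚ n} {c d : Fin n} {h p : ℚ} → mrca S a b ≡ just h → mrca T c d ≡ just p →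
                   dist S a b ℚ.≤ dist T c d → h ℚ.≤ p
  mrca-≤-of-dist {a = a} {b = b} {S = S} {T} {c} {d} eh ep S≤T =
    double-cancel-≤ (subst₂ ℚ._≤_ (trans (dist-mrca S a b) (cong (maybe _ 0ℚ) eh))
                                  (trans (dist-mrca T c d) (cong (maybe _ 0ℚ) ep)) S≤T)

  internals-≤-time : (T : Tree ℚ n) → NonnegEdges T → All (ℚ._≤ time T) (internals T)
  internals-≤-time (leaf _)     _                     = []
  internals-≤-time (node t l r) (l≤t , r≤t , nl , nr) =
    ℚₚ.≤-refl ∷ ++⁺ (All.map (λ u≤ → ℚₚ.≤-trans u≤ l≤t) (internals-≤-time l nl))
                    (All.map (λ u≤ → ℚₚ.≤-trans u≤ r≤t) (internals-≤-time r nr))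

  nonnegEdges⇒heap : (T : Tree ℚ n) → NonnegEdges T → Unique (internals T) → Heap ℚ._<_ T
  nonnegEdges⇒heap (leaf _)     _                     _        = leaf
  nonnegEdges⇒heap (node t l r) (l≤t , r≤t , nl , nr) (t∉ ∷ U) =
    node (strictly l≤t (internals-≤-time l nl) (++⁻ˡ (internals l) t∉))
         (strictly r≤t (internals-≤-time r nr) (++⁻ʳ (internals l) t∉))
         (nonnegEdges⇒heap l nl (proj₁ (Unique-++⁻ (internals l) U)))
         (nonnegEdges⇒heap r nr (proj₁ (proj₂ (Unique-++⁻ (internals l) U))))
    where
    strictly : {C : Tree ℚ n} → time C ℚ.≤ t → All (ℚ._≤ time C) (internals C) →
               All (t ≢_) (internals C) → All (ℚ._< t) (internals C)
    strictly C≤t below t∉C =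
      All.zipWith (λ (u≤ , t≢u) → ≤∧≢⇒< (ℚₚ.≤-trans u≤ C≤t) (t≢u ∘ sym)) (below , t∉C)

-- Nesting sequences and nested trees

data Alternating : List ℚ → List ℚ → Set where
  []  : Alternating [] []
  _∷_ : {h p : ℚ} {hs ps : List ℚ} → All (p ℚ.<_) hs → Alternating hs ps →
        Alternating (h ∷ hs) (p ∷ ps)

alternating-rank-≤ : {h : ℚ} {hs ps : List ℚ} → AllPairs ℚ._<_ hs → Alternating hs ps →
                     h ∈ hs → h ℚ.≤ t → countBelow hs h ≤ countBelow ps t
alternating-rank-≤ (h<hs ∷ _) _ (here refl) _ = subst (_≤ _) (sym (countBelow-least h<hs)) z≤n
alternating-rank-≤ {hs = _ ∷ hs} {ps = _ ∷ ps} (h₀<hs ∷ hs↗) (p₀<hs ∷ alt) (there h∈) h≤t =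
  subst₂ _≤_ (sym (countBelow-accept {xs = hs} (All.lookup h₀<hs h∈)))
             (sym (countBelow-accept {xs = ps} (ℚₚ.<-≤-trans (All.lookup p₀<hs h∈) h≤t)))
             (s≤s (alternating-rank-≤ hs↗ alt h∈ h≤t))

alternating-partner : {h : ℚ} {hs ps : List ℚ} → AllPairs ℚ._<_ hs → AllPairs ℚ._<_ ps →
                      Alternating hs ps → h ∈ hs → ∃ λ p → p ∈ ps × countBelow ps p ≡ countBelow hs h
alternating-partner (h<hs ∷ _) (p<ps ∷ _) (_ ∷ _) (here refl) =
  _ , here refl , trans (countBelow-least p<ps) (sym (countBelow-least h<hs))
alternating-partner {hs = _ ∷ hs} {ps = _ ∷ ps} (h₀<hs ∷ hs↗) (p₀<ps ∷ ps↗) (_ ∷ alt) (there h∈) =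
  let p , p∈ , e = alternating-partner hs↗ ps↗ alt h∈
  in  p , there p∈ , trans (countBelow-accept {xs = ps} (All.lookup p₀<ps p∈))
                           (trans (cong suc e) (sym (countBelow-accept {xs = hs} (All.lookup h₀<hs h∈))))

mergeTag-H : {h : ℚ} {hs ps : List ℚ} {rest : List HP} →
             mergeTag (h ∷ hs) ps ≡ H ∷ rest → mergeTag hs ps ≡ rest
mergeTag-H {ps = []}            refl = refl
mergeTag-H {h = h} {ps = p ∷ _} e with h ℚ.<? p
mergeTag-H                      refl | yes _ = refl

mergeTag-P : {p : ℚ} {hs ps : List ℚ} {rest : List HP} → AllPairs ℚ._<_ hs → p ∉ hs →
             mergeTag hs (p ∷ ps) ≡ P ∷ rest → All (p ℚ.<_) hs × mergeTag hs ps ≡ rest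
mergeTag-P {hs = []}                       _ _ refl = [] , refl
mergeTag-P {p = p} {hs = h ∷ _} (h<hs ∷ _) p∉hs e with h ℚ.<? p
mergeTag-P {p = p} {hs = h ∷ _} (h<hs ∷ _) p∉hs refl | no h≮p = p<h ∷ All.map (ℚₚ.<-trans p<h) h<hs , refl
  where
  p<h : p ℚ.< h
  p<h = ≤∧≢⇒< (ℚₚ.≮⇒≥ h≮p) (λ p≡h → p∉hs (here p≡h))

alternating : ∀ k {hs ps : List ℚ} → AllPairs ℚ._<_ hs → Disjoint hs ps →
              mergeTag hs ps ≡ HPpow k → Alternating hs ps
alternating zero    {[]}        {[]}     _ _ _  = []
alternating zero    {[]}        {_ ∷ _}  _ _ ()
alternating zero    {_ ∷ _}     {[]}     _ _ ()
alternating zero    {h ∷ _}     {p ∷ _}  _ _ e  with h ℚ.<? p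
alternating zero    {h ∷ _}     {p ∷ _}  _ _ () | yes _
alternating zero    {h ∷ _}     {p ∷ _}  _ _ () | no _
alternating (suc k) {[]}        {[]}     _ _ ()
alternating (suc k) {[]}        {_ ∷ _}  _ _ ()
alternating (suc k) {_ ∷ []}    {[]}     _ _ ()
alternating (suc k) {_ ∷ _ ∷ _} {[]}     _ _ ()
alternating (suc k) {h ∷ hs}    {p ∷ ps} (_ ∷ hs↗) h∷hs#p∷ps e =
  let p<hs , e′ = mergeTag-P hs↗ (λ p∈hs → h∷hs#p∷ps (there p∈hs , here refl))
                             (mergeTag-H {h = h} {hs} {p ∷ ps} e)
  in  p<hs ∷ alternating k hs↗ (λ (u∈hs , u∈ps) → h∷hs#p∷ps (there u∈hs , there u∈ps)) e′

sort-strict : {xs : List ℚ} → Unique xs → AllPairs ℚ._<_ (sort xs)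
sort-strict {xs} U =
  AllPairs.zipWith (λ (u≤v , u≢v) → ≤∧≢⇒< u≤v u≢v)
                   (Linked⇒AllPairs ℚₚ.≤-trans (sort-↗ xs) , Unique-resp-↭ (↭-sym (sort-↭ xs)) U)

sort-alternating : ∀ k {hs ps : List ℚ} → Unique (hs ++ ps) → mergeTag (sort hs) (sort ps) ≡ HPpow k →
                   Alternating (sort hs) (sort ps)
sort-alternating k {hs} {ps} U e =
  let Uh , _ , h#p = Unique-++⁻ hs U
  in  alternating k (sort-strict Uh)
                    (λ (u∈h , u∈p) → h#p (∈-resp-↭ (sort-↭ hs) u∈h , ∈-resp-↭ (sort-↭ ps) u∈p)) e

module _ {n k : ℕ} {TH TP : Tree ℚ n} (resolved : FullyResolved TH TP)
         (sequence : nestingSeq TH TP ≡ HPpow k) where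

  private
    IH IP : List ℚ
    IH = internals TH
    IP = internals TP

    sorted-H : AllPairs ℚ._<_ (sort IH)
    sorted-H = sort-strict (proj₁ (Unique-++⁻ IH resolved))

    sorted-P : AllPairs ℚ._<_ (sort IP)
    sorted-P = sort-strict (proj₁ (proj₂ (Unique-++⁻ IH resolved)))

    alternates : Alternating (sort IH) (sort IP)
    alternates = sort-alternating k {IH} {IP} resolved sequence

  nesting-rank-≤ : {h : ℚ} → h ∈ internals TH → h ℚ.≤ t → rankIn TH h ≤ rankIn TP t
  nesting-rank-≤ h∈ h≤t =
    subst₂ _≤_ (countBelow-↭ (sort-↭ IH)) (countBelow-↭ (sort-↭ IP))
      (alternating-rank-≤ sorted-H alternates (∈-resp-↭ (↭-sym (sort-↭ IH)) h∈) h≤t)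

  nesting-ranks-⊆ : {j : ℕ} → j ∈ internals (rankBy TH TH) → j ∈ internals (rankBy TP TP)
  nesting-ranks-⊆ {j} j∈ with ∈-map⁻ (rankIn TH) (subst (j ∈_) (internals-rankBy TH) j∈)
  ... | h , h∈ , refl
    with alternating-partner sorted-H sorted-P alternates (∈-resp-↭ (↭-sym (sort-↭ IH)) h∈)
  ... | p , p∈ , e =
    subst (_∈ internals (rankBy TP TP))
          (trans (sym (countBelow-↭ (sort-↭ IP))) (trans e (countBelow-↭ (sort-↭ IH))))
          (subst (rankIn TP p ∈_) (sym (internals-rankBy TP))
                 (∈-map⁺ (rankIn TP) (∈-resp-↭ (sort-↭ IP) p∈)))

module _ {n : ℕ} where

  rankBy-isRankedTree : {T : Tree ℚ n} → IsUltrametricBinaryTree T → Unique (internals T) →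
                        IsRankedTree (rankBy T T)
  rankBy-isRankedTree {T} (leaves↭ , nonneg) U = record
    { complete      = rankBy-∈ ∘ spanning-complete leaves↭
    ; unique-leaves = rankBy-uniqueLeaves (spanning-uniqueLeaves leaves↭)
    ; heap          = rankBy-heap T (nonnegEdges⇒heap T nonneg U) (λ u∈ → u∈)
    ; unique-ranks  = subst Unique (sym (internals-rankBy T)) (Unique-map⁺ countBelow-injective U)
    }

  relabel-isRankedTree : {f : Fin n → Fin n} {Z : Tree ℕ n} → Bijective _≡_ _≡_ f →
                         IsRankedTree Z → IsRankedTree (relabel f Z)
  relabel-isRankedTree {f} {Z} (injective , surjective) Z-ranked = record
    { complete      = λ b → let a , fa≡b = surjective b
                            in  subst (_∈ᵀ relabel f Z) (fa≡b refl) (relabel-∈ (complete a))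
    ; unique-leaves = relabel-uniqueLeaves injective Z unique-leaves
    ; heap          = relabel-heap Z heap
    ; unique-ranks  = subst Unique (sym (internals-relabel Z)) unique-ranks
    }
    where open IsRankedTree Z-ranked

  nested⇒height-≤ : {ℓ : Fin n → Fin n} {TH TP : Tree ℚ n} → Bijective _≡_ _≡_ ℓ →
                    IsUltrametricBinaryTree TH → IsUltrametricBinaryTree TP → IsNested ℓ TH TP →
                    (∀ {h t} → h ∈ internals TH → h ℚ.≤ t → rankIn TH h ≤ rankIn TP t) →
                    ∀ a b → height (rankBy TH TH) a b ≤ height (relabel ℓ (rankBy TP TP)) a b
  nested⇒height-≤ {ℓ} {TH} {TP} (injective , surjective) (H-leaves , _) (P-leaves , _) nested rank-≤ =
    surjective-∀₂ surjective λ i j → subst (_ ≤_) (sym (height-relabel injective (rankBy TP TP))) (at i j)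
    where
    uH : UniqueLeaves TH
    uH = spanning-uniqueLeaves H-leaves

    cH : ∀ a → a ∈ᵀ TH
    cH = spanning-complete H-leaves

    cP : ∀ a → a ∈ᵀ TP
    cP = spanning-complete P-leaves

    at : ∀ i j → height (rankBy TH TH) (ℓ i) (ℓ j) ≤ height (rankBy TP TP) i j
    at i j with i ≟ᶠ j
    ... | yes refl = subst (_≤ _) (sym (height-self (rankBy-uniqueLeaves uH) (rankBy-∈ (cH (ℓ i))))) z≤n
    ... | no i≢j
      with h , eh ← mrca-just uH (cH (ℓ i)) (cH (ℓ j)) (i≢j ∘ injective)
         | p , ep ← mrca-just (spanning-uniqueLeaves P-leaves) (cP i) (cP j) i≢j
      = subst₂ _≤_ (sym (height-rankBy eh)) (sym (height-rankBy ep))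
               (s≤s (rank-≤ (mrca-internal TH eh) (mrca-≤-of-dist eh ep (nested i j))))

mainTheorem8 : (n : ℕ) → 2 ≤ n → (ℓ : Fin n → Fin n) → Bijective _≡_ _≡_ ℓ →
    (TH TP : Tree ℚ n) →
    IsUltrametricBinaryTree TH → IsUltrametricBinaryTree TP →
    IsNested ℓ TH TP → FullyResolved TH TP →
    nestingSeq TH TP ≡ HPpow (n ∸ 1) →
    rankedTopology TH ≅ relabel ℓ (rankedTopology TP)
mainTheorem8 n _ ℓ ℓ-bijective TH TP TH-ultrametric TP-ultrametric nested resolved sequence =
  subst₂ _≅_ (sym (rankedTopology≡rankBy TH)) (cong (relabel ℓ) (sym (rankedTopology≡rankBy TP)))
    (heights⇒≅ X-ranked Y-ranked (heights-agree X-ranked Y-ranked X≤Y X⊆Y))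
  where
  X-ranked : IsRankedTree (rankBy TH TH)
  X-ranked = rankBy-isRankedTree TH-ultrametric (proj₁ (Unique-++⁻ (internals TH) resolved))

  Y-ranked : IsRankedTree (relabel ℓ (rankBy TP TP))
  Y-ranked = relabel-isRankedTree ℓ-bijective
               (rankBy-isRankedTree TP-ultrametric (proj₁ (proj₂ (Unique-++⁻ (internals TH) resolved))))

  X≤Y : ∀ a b → height (rankBy TH TH) a b ≤ height (relabel ℓ (rankBy TP TP)) a b
  X≤Y = nested⇒height-≤ ℓ-bijective TH-ultrametric TP-ultrametric nested (nesting-rank-≤ resolved sequence)

  X⊆Y : ∀ {j} → j ∈ internals (rankBy TH TH) → j ∈ internals (relabel ℓ (rankBy TP TP))
  X⊆Y = subst (_ ∈_) (sym (internals-relabel (rankBy TP TP))) ∘ nesting-ranks-⊆ resolved sequence
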